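{- Let $\Sigma$ be an alphabet, $w\in\Sigma^*$ and $1\le m<\lvert w\rvert$, and let $w^*$ be an optimal solution of the approximate string cover problem (specific version, cover length $m$) for $w$ with respect to the Hamming distance $d$. Then $\lvert w\rvert-d(w,w^*)\ge\max_{\alpha\in\Sigma}\mathrm{freq}_w(\alpha)$.
   Context: $\mathrm{freq}_w(\alpha)$ is the number of occurrences of $\alpha$ in $w$. A tiling of size $n$ is a set $\mathcal{I}=\{\mathcal{I}_1<\dots<\mathcal{I}_k\}\subseteq\{1,\dots,n\}$ with $\mathcal{I}_1=1$, norm $\lVert\mathcal{I}\rVert=n+1-\mathcal{I}_k$, and $\mathcal{I}_{i+1}-\mathcal{I}_i\le\lVert\mathcal{I}\rVert$. A word $s$ with $\lvert s\rvert=\lVert\mathcal{I}\rVert$ is valid for $\mathcal{I}$ if copies of $s$ placed starting at the positions $\mathcal{I}_i$ agree on all overlaps, and then $\mathcal{I}(s)\in\Sigma^n$ is the resulting string. The approximate string cover problem (specific version): given $w$ and $m<\lvert w\rvert$, find a tiling $\mathcal{I}$ of size $\lvert w\rvert$ with $\lVert\mathcal{I}\rVert=m$ and $s$ valid for $\mathcal{I}$ minimizing $d(w,\mathcal{I}(s))$; $w^*=\mathcal{I}(s)$ for an optimal pair. -}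

module Defs where

open import Data.Nat using (ℕ; zero; suc; _+_; _∸_; _≤_; _<_)
open import Data.Fin using (Fin; toℕ)
open import Data.List using (List; length; filter; head; last)
open import Data.List.Base using (allFin)
open import Data.List.Membership.Propositional using (_∈_)
open import Data.List.Relation.Unary.Linked using (Linked)
open import Data.Maybe using (just)
open import Data.Product using (_×_; Σ; ∃)
open import Relation.Binary.PropositionalEquality using (_≡_)
open import Relation.Binary.Definitions using (DecidableEquality)
open import Relation.Nullary.Decidable using (¬?)

Word : Set → ℕ → Set
Word A n = Fin n → A

module _ {A : Set} (_≟_ : DecidableEquality A) where

  freq : ∀ {n} → Word A n → A → ℕ
  freq {n} w α = length (filter (λ p → w p ≟ α) (allFin n))

  hamming : ∀ {n} → Word A n → Word A n → ℕ
  hamming {n} u v = length (filter (λ p → ¬? (u p ≟ v p)) (allFin n))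

-- A tiling of size n with norm m, 0-indexed (paper position I_i = our I_i + 1):
-- strictly increasing list of starting positions, first is 0, last element ℓ
-- satisfies ℓ < n and n ∸ ℓ = m (the norm), and consecutive gaps are ≤ m.
record IsTiling (n m : ℕ) (I : List ℕ) : Set where
  field
    starts-at-0 : head I ≡ just 0
    last-pos    : Σ ℕ λ ℓ → (last I ≡ just ℓ) × (ℓ < n) × (n ∸ ℓ ≡ m)
    gaps        : Linked (λ a b → (a < b) × (b ≤ a + m)) I

-- s (of length m) is valid for I: copies of s at all starting positions agree on overlaps
Valid : {A : Set} {m : ℕ} → List ℕ → Word A m → Set
Valid {m = m} I s =
  ∀ {i j} → i ∈ I → j ∈ I → (k k′ : Fin m) → i + toℕ k ≡ j + toℕ k′ → s k ≡ s k′

-- u is the string I(s): every copy of s placed at a position of I agrees with u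
Generates : {A : Set} {n m : ℕ} → List ℕ → Word A m → Word A n → Set
Generates {n = n} {m} I s u =
  ∀ {i} → i ∈ I → (k : Fin m) (p : Fin n) → i + toℕ k ≡ toℕ p → u p ≡ s k

IsCoverString : {A : Set} (n m : ℕ) → Word A n → Set
IsCoverString {A} n m u =
  Σ (List ℕ) λ I → Σ (Word A m) λ s → IsTiling n m I × Valid I s × Generates I s u

IsOptimalCover : {A : Set} → DecidableEquality A → {n : ℕ} (m : ℕ) → Word A n → Word A n → Set
IsOptimalCover _≟_ {n} m w w* =
  IsCoverString n m w* ×
  (∀ u → IsCoverString n m u → hamming _≟_ w w* ≤ hamming _≟_ w u)

module Submission where

-- For every letter α the constant word αⁿ is itself a cover
-- string of norm m: take the tiling with every position 0, 1, …, n − m as a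
-- start and s = αᵐ, which is trivially valid.  Its Hamming distance to w is
-- exactly the number of positions of w not carrying α, i.e. n − freq_w(α).
-- Optimality of w* gives d(w, w*) ≤ d(w, αⁿ) = n − freq_w(α), which
-- rearranges to the claim n − d(w, w*) ≥ freq_w(α).

open import Defs
open import Data.Nat using (ℕ; zero; suc; _+_; _∸_; _≤_; _<_; _≥_)
open import Data.Nat.Properties
  using (+-suc; +-comm; +-monoʳ-≤; ≤-refl; ≤-trans; ≤-reflexive;
         <⇒≤; ∸-monoʳ-<; ∸-monoʳ-≤; m∸[m∸n]≡n; m+n∸m≡n; module ≤-Reasoning)
open import Data.Fin using (Fin)
open import Data.List using (List; []; _∷_; length; filter; head; last)
open import Data.List.Base using (allFin)
open import Data.List.Properties using (length-tabulate)
open import Data.List.Relation.Unary.Linked using (Linked; [-]; _∷_)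
open import Data.Maybe using (just)
open import Data.Product using (_×_; _,_)
open import Data.Bool using (true; false)
open import Function using (_∘_)
open import Relation.Binary.Core using (Rel)
open import Relation.Binary.Definitions using (DecidableEquality)
open import Relation.Binary.PropositionalEquality using (_≡_; refl; sym; trans; cong)
open import Relation.Nullary using (does)
open import Relation.Nullary.Decidable using (¬?)
open import Relation.Unary using (Pred; Decidable)

consecutive : ℕ → ℕ → List ℕ
consecutive a zero    = a ∷ []
consecutive a (suc k) = a ∷ consecutive (suc a) k

head-consecutive : ∀ a k → head (consecutive a k) ≡ just a
head-consecutive a zero    = refl
head-consecutive a (suc k) = refl

last-consecutive : ∀ a k → last (consecutive a k) ≡ just (a + k)
last-consecutive a zero          = cong just (+-comm 0 a)
last-consecutive a (suc zero)    = cong just (+-comm 1 a)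
last-consecutive a (suc (suc k)) =
  trans (last-consecutive (suc a) (suc k)) (cong just (sym (+-suc a (suc k))))

consecutive-linked : ∀ {ℓ} {R : Rel ℕ ℓ} → (∀ x → R x (suc x)) →
  ∀ a k → Linked R (consecutive a k)
consecutive-linked step a zero          = [-]
consecutive-linked step a (suc zero)    = step a ∷ [-]
consecutive-linked step a (suc (suc k)) = step a ∷ consecutive-linked step (suc a) (suc k)

consecutive-tiling : ∀ {n m} → 1 ≤ m → m ≤ n → IsTiling n m (consecutive 0 (n ∸ m))
consecutive-tiling {n} {m} 1≤m m≤n = record
  { starts-at-0 = head-consecutive 0 (n ∸ m)
  ; last-pos    = n ∸ m , last-consecutive 0 (n ∸ m)
                , ∸-monoʳ-< {n} {m} {0} 1≤m m≤n
                , m∸[m∸n]≡n m≤n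
  ; gaps        = consecutive-linked unit-gap 0 (n ∸ m)
  }
  where
    unit-gap : ∀ x → (x < suc x) × (suc x ≤ x + m)
    unit-gap x = ≤-refl , ≤-trans (≤-reflexive (+-comm 1 x)) (+-monoʳ-≤ x 1≤m)

constant-isCoverString : ∀ {A : Set} {n m} → 1 ≤ m → m ≤ n → (α : A) →
  IsCoverString n m (λ (_ : Fin n) → α)
constant-isCoverString {n = n} {m} 1≤m m≤n α =
  consecutive 0 (n ∸ m) , (λ _ → α) , consecutive-tiling 1≤m m≤n
  , (λ _ _ _ _ _ → refl) , (λ _ _ _ _ → refl)

length-filter-complement : ∀ {a p} {X : Set a} {P : Pred X p} (P? : Decidable P) →
  (xs : List X) → length (filter (¬? ∘ P?) xs) + length (filter P? xs) ≡ length xs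
length-filter-complement P? []       = refl
length-filter-complement P? (x ∷ xs) with does (P? x)
... | true  = trans (+-suc _ _) (cong suc (length-filter-complement P? xs))
... | false = cong suc (length-filter-complement P? xs)

module _ {A : Set} (_≟_ : DecidableEquality A) where

  hamming-constant : ∀ {n} (w : Word A n) (α : A) →
    hamming _≟_ w (λ _ → α) + freq _≟_ w α ≡ n
  hamming-constant {n} w α =
    trans (length-filter-complement (λ p → w p ≟ α) (allFin n)) (length-tabulate _)

  freq-complement : ∀ {n} (w : Word A n) (α : A) →
    freq _≟_ w α ≡ n ∸ hamming _≟_ w (λ _ → α)
  freq-complement {n} w α =
    trans (sym (m+n∸m≡n (hamming _≟_ w (λ _ → α)) _))
          (cong (_∸ hamming _≟_ w (λ _ → α)) (hamming-constant w α))

corollary1 : {A : Set} (_≟_ : DecidableEquality A) (n : ℕ) (w : Word A n) (m : ℕ) →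
    1 ≤ m → m < n → (w* : Word A n) → IsOptimalCover _≟_ m w w* →
    ∀ (α : A) → n ∸ hamming _≟_ w w* ≥ freq _≟_ w α
corollary1 _≟_ n w m 1≤m m<n w* (_ , optimal) α = begin
  freq _≟_ w α                   ≡⟨ freq-complement _≟_ w α ⟩
  n ∸ hamming _≟_ w (λ _ → α)    ≤⟨ ∸-monoʳ-≤ n closer ⟩
  n ∸ hamming _≟_ w w*           ∎
  where
    open ≤-Reasoning
    closer : hamming _≟_ w w* ≤ hamming _≟_ w (λ _ → α)
    closer = optimal (λ _ → α) (constant-isCoverString 1≤m (<⇒≤ m<n) α)
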